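{- Let $u\in\{0,1\}^*$. Then $$\#\left\{v\in L_2 : \binom{101u}{v}>0\right\}=\#\left\{v\in L_2 : \binom{1u}{v}>0\right\}+\#\left\{v\in L_2 : \binom{11u}{v}>0\right\}.$$
   Context: For finite words $u,v$ over $\{0,1\}$, $\binom{u}{v}$ is the number of occurrences of $v$ as a (scattered) subword (subsequence) of $u$. $L_2=\{\varepsilon\}\cup 1\{0,1\}^*$. -}

module Defs where

open import Data.Bool using (Bool; true; false; if_then_else_)
open import Data.Nat using (ℕ; zero; suc; _+_; _<_; _<?_)
open import Data.List using (List; []; _∷_; _++_; map; length; filter; concatMap)
open import Relation.Nullary.Decidable using (Dec; yes; no)

-- Binary words over the alphabet {0,1}; 0 is encoded by false, 1 by true.
Word : Set
Word = List Bool

-- Binomial coefficient of words: number of occurrences of v as a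
-- scattered subword (subsequence) of u.
--   binom u ε = 1,  binom ε (b v) = 0,
--   binom (a u) (b v) = binom u (b v) + [a = b] * binom u v
_≟b_ : Bool → Bool → Bool
true  ≟b true  = true
false ≟b false = true
_     ≟b _     = false

binom : Word → Word → ℕ
binom u       []      = 1
binom []      (_ ∷ _) = 0
binom (a ∷ u) (b ∷ v) = binom u (b ∷ v) + (if a ≟b b then binom u v else 0)

data L₂ : Word → Set where
  L₂-ε : L₂ []
  L₂-1 : ∀ v → L₂ (true ∷ v)

L₂? : (v : Word) → Dec (L₂ v)
L₂? [] = yes L₂-ε
L₂? (true ∷ v) = yes (L₂-1 v)
L₂? (false ∷ v) = no (λ ())

wordsOfLength : ℕ → List Word
wordsOfLength zero = [] ∷ []
wordsOfLength (suc n) = concatMap (λ w → (false ∷ w) ∷ (true ∷ w) ∷ []) (wordsOfLength n)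

wordsUpTo : ℕ → List Word
wordsUpTo zero = wordsOfLength zero
wordsUpTo (suc n) = wordsUpTo n ++ wordsOfLength (suc n)

data Counted (w v : Word) : Set where
  counted : L₂ v → 0 < binom w v → Counted w v

Counted? : (w v : Word) → Dec (Counted w v)
Counted? w v with L₂? v | 0 <? binom w v
... | yes p | yes q = yes (counted p q)
... | no ¬p | _     = no (λ { (counted p _) → ¬p p })
... | _     | no ¬q = no (λ { (counted _ q) → ¬q q })

-- # { v ∈ L₂ : binom w v > 0 }.  Any v with binom w v > 0 has
-- length v ≤ length w, so the set is exactly the elements of
-- wordsUpTo (length w) satisfying the predicate (each listed once).
countL₂ : Word → ℕ
countL₂ w = length (filter (Counted? w) (wordsUpTo (length w)))

-- Write v ⊑ w when binom w v > 0. An occurrence of a·v in a·w either uses the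
-- first letter or not, so a·v ⊑ a·w iff v ⊑ w, while b·v ⊑ a·w iff b·v ⊑ w for
-- b ≠ a. Writing S(w) for the set of distinct subwords of w, the words of L₂
-- occurring in 1w are therefore ε and 1·S(w), so the count for 1w is 1 + |S(w)|;
-- and S(01u) = {ε} ∪ 0·S(1u) ∪ 1·S(u). The count for 101u is thus
-- 1 + |S(01u)| = (1 + |S(u)|) + (1 + |S(1u)|), the counts for 1u and 11u.
module Submission where

open import Defs
open import Level using (Level)
open import Data.Bool using (true; false; not; if_then_else_)
open import Data.Nat using (ℕ; zero; suc; _+_; _<_; _≤_; z≤n; s≤s; z<s; _<?_)
open import Data.Nat.Properties
  using (≤-refl; ≤-trans; m≤n+m; m≤m+n; m≤n⇒m≤1+n; <⇒≱; +-identityʳ)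
open import Data.Nat.ListAction using (sum)
open import Data.Nat.ListAction.Properties using (sum-++)
open import Data.Nat.Tactic.RingSolver using (solve-∀)
open import Data.List using (List; []; _∷_; _++_; map; length; filter; concatMap)
open import Data.List.Properties using (map-++; map-cong)
open import Data.Sum using (_⊎_; inj₁; inj₂; map₂)
open import Function using (_∘_; _⇔_; mk⇔; module Equivalence)
open import Function.Properties.Equivalence using () renaming (trans to ⇔-trans)
open import Relation.Nullary using (¬_)
open import Relation.Nullary.Decidable using (Dec; does; dec-false; does-⇔)
open import Relation.Unary using (Decidable)
open import Relation.Binary.PropositionalEquality
  using (_≡_; _≗_; refl; sym; trans; cong; cong₂; subst; module ≡-Reasoning)

private
  variable
    ℓ p : Level
    A : Set ℓ

∑ : List A → (A → ℕ) → ℕ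
∑ xs f = sum (map f xs)

∑-cong : ∀ {f g : A → ℕ} xs → f ≗ g → ∑ xs f ≡ ∑ xs g
∑-cong xs f≗g = cong sum (map-cong f≗g xs)

∑-++ : ∀ xs ys (f : A → ℕ) → ∑ (xs ++ ys) f ≡ ∑ xs f + ∑ ys f
∑-++ xs ys f = trans (cong sum (map-++ f xs ys)) (sum-++ (map f xs) (map f ys))

∑-zero : ∀ {f : A → ℕ} xs → (∀ x → f x ≡ 0) → ∑ xs f ≡ 0
∑-zero []       f≡0 = refl
∑-zero (x ∷ xs) f≡0 = cong₂ _+_ (f≡0 x) (∑-zero xs f≡0)

𝟙[_] : {P : Set p} → Dec P → ℕ
𝟙[ P? ] = if does P? then 1 else 0

𝟙-no : {P : Set p} (P? : Dec P) → ¬ P → 𝟙[ P? ] ≡ 0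
𝟙-no P? ¬x = cong (if_then 1 else 0) (dec-false P? ¬x)

𝟙-⇔ : {P Q : Set p} → P ⇔ Q → (P? : Dec P) (Q? : Dec Q) → 𝟙[ P? ] ≡ 𝟙[ Q? ]
𝟙-⇔ P⇔Q P? Q? = cong (if_then 1 else 0) (does-⇔ P⇔Q P? Q?)

length-filter≡∑𝟙 : {P : A → Set p} (P? : Decidable P) (xs : List A) →
                   length (filter P? xs) ≡ ∑ xs (λ x → 𝟙[ P? x ])
length-filter≡∑𝟙 P? []       = refl
length-filter≡∑𝟙 P? (x ∷ xs) with does (P? x)
... | true  = cong suc (length-filter≡∑𝟙 P? xs)
... | false = length-filter≡∑𝟙 P? xs

∑-doubling : ∀ (f : Word → ℕ) ws →
             ∑ (concatMap (λ w → (false ∷ w) ∷ (true ∷ w) ∷ []) ws) f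
               ≡ ∑ ws (f ∘ (false ∷_)) + ∑ ws (f ∘ (true ∷_))
∑-doubling f []       = refl
∑-doubling f (w ∷ ws) = trans (cong (λ s → f (false ∷ w) + (f (true ∷ w) + s)) (∑-doubling f ws))
                              (interchange (f (false ∷ w)) (f (true ∷ w)) (∑ ws (f ∘ (false ∷_))) (∑ ws (f ∘ (true ∷_))))
  where
  interchange : ∀ a b c d → a + (b + (c + d)) ≡ (a + c) + (b + d)
  interchange = solve-∀

∑-wordsOfLength-suc : ∀ n (f : Word → ℕ) →
  ∑ (wordsOfLength (suc n)) f ≡ ∑ (wordsOfLength n) (f ∘ (false ∷_)) + ∑ (wordsOfLength n) (f ∘ (true ∷_))
∑-wordsOfLength-suc n f = ∑-doubling f (wordsOfLength n)

∑-wordsOfLength-vanishing : ∀ n (f : Word → ℕ) → (∀ v → length v ≡ n → f v ≡ 0) →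
                            ∑ (wordsOfLength n) f ≡ 0
∑-wordsOfLength-vanishing zero    f f≡0 = cong (_+ 0) (f≡0 [] refl)
∑-wordsOfLength-vanishing (suc n) f f≡0 = begin
  ∑ (wordsOfLength (suc n)) f                                              ≡⟨ ∑-wordsOfLength-suc n f ⟩
  ∑ (wordsOfLength n) (f ∘ (false ∷_)) + ∑ (wordsOfLength n) (f ∘ (true ∷_)) ≡⟨ cong₂ _+_ (vanish false) (vanish true) ⟩
  0                                                                        ∎
  where
  open ≡-Reasoning
  vanish : ∀ b → ∑ (wordsOfLength n) (f ∘ (b ∷_)) ≡ 0
  vanish b = ∑-wordsOfLength-vanishing n (f ∘ (b ∷_)) (λ v |v|≡n → f≡0 (b ∷ v) (cong suc |v|≡n))

∑-wordsUpTo-suc : ∀ n (f : Word → ℕ) →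
  ∑ (wordsUpTo (suc n)) f ≡ f [] + ∑ (wordsUpTo n) (f ∘ (false ∷_)) + ∑ (wordsUpTo n) (f ∘ (true ∷_))
∑-wordsUpTo-suc zero    f = rearrange (f []) (f (false ∷ [])) (f (true ∷ []))
  where
  rearrange : ∀ a b c → a + (b + (c + 0)) ≡ a + (b + 0) + (c + 0)
  rearrange = solve-∀
∑-wordsUpTo-suc (suc n) f = begin
  ∑ (wordsUpTo (suc n) ++ wordsOfLength (suc (suc n))) f
    ≡⟨ ∑-++ (wordsUpTo (suc n)) _ f ⟩
  ∑ (wordsUpTo (suc n)) f + ∑ (wordsOfLength (suc (suc n))) f
    ≡⟨ cong₂ _+_ (∑-wordsUpTo-suc n f) (∑-wordsOfLength-suc (suc n) f) ⟩
  (f [] + ∑ (wordsUpTo n) f₀ + ∑ (wordsUpTo n) f₁) + (∑ (wordsOfLength (suc n)) f₀ + ∑ (wordsOfLength (suc n)) f₁)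
    ≡⟨ rearrange (f []) (∑ (wordsUpTo n) f₀) (∑ (wordsUpTo n) f₁) (∑ (wordsOfLength (suc n)) f₀) (∑ (wordsOfLength (suc n)) f₁) ⟩
  f [] + (∑ (wordsUpTo n) f₀ + ∑ (wordsOfLength (suc n)) f₀) + (∑ (wordsUpTo n) f₁ + ∑ (wordsOfLength (suc n)) f₁)
    ≡⟨ sym (cong₂ (λ s t → f [] + s + t) (∑-++ (wordsUpTo n) _ f₀) (∑-++ (wordsUpTo n) _ f₁)) ⟩
  f [] + ∑ (wordsUpTo (suc n)) f₀ + ∑ (wordsUpTo (suc n)) f₁
    ∎
  where
  open ≡-Reasoning
  f₀ f₁ : Word → ℕ
  f₀ = f ∘ (false ∷_)
  f₁ = f ∘ (true ∷_)
  rearrange : ∀ a b c d e → (a + b + c) + (d + e) ≡ a + (b + d) + (c + e)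
  rearrange = solve-∀

∑-wordsUpTo-suc-vanishing : ∀ n (f : Word → ℕ) → (∀ v → length v ≡ suc n → f v ≡ 0) →
                            ∑ (wordsUpTo (suc n)) f ≡ ∑ (wordsUpTo n) f
∑-wordsUpTo-suc-vanishing n f f≡0 = begin
  ∑ (wordsUpTo n ++ wordsOfLength (suc n)) f            ≡⟨ ∑-++ (wordsUpTo n) _ f ⟩
  ∑ (wordsUpTo n) f + ∑ (wordsOfLength (suc n)) f       ≡⟨ cong (∑ (wordsUpTo n) f +_) (∑-wordsOfLength-vanishing (suc n) f f≡0) ⟩
  ∑ (wordsUpTo n) f + 0                                 ≡⟨ +-identityʳ _ ⟩
  ∑ (wordsUpTo n) f                                     ∎
  where open ≡-Reasoning

infix 4 _⊑_ _⊑?_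

_⊑_ : Word → Word → Set
v ⊑ w = 0 < binom w v

_⊑?_ : ∀ v w → Dec (v ⊑ w)
v ⊑? w = 0 <? binom w v

⊑-∷ʳ : ∀ a v w → v ⊑ w → v ⊑ a ∷ w
⊑-∷ʳ a []      w v⊑w = v⊑w
⊑-∷ʳ a (b ∷ v) w v⊑w = ≤-trans v⊑w (m≤m+n _ _)

⊑-∷⁻ : ∀ a b v w → b ∷ v ⊑ a ∷ w → b ∷ v ⊑ w ⊎ v ⊑ w
⊑-∷⁻ a b v w bv⊑aw = map₂ (if-pos (a ≟b b)) (+-pos (binom w (b ∷ v)) bv⊑aw)
  where
  +-pos : ∀ m {n} → 0 < m + n → 0 < m ⊎ 0 < n
  +-pos zero    0<n = inj₂ 0<n
  +-pos (suc m) _   = inj₁ z<s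
  if-pos : ∀ c {n} → 0 < (if c then n else 0) → 0 < n
  if-pos true 0<n = 0<n

⊑-∷ˡ⁻ : ∀ b v w → b ∷ v ⊑ w → v ⊑ w
⊑-∷ˡ⁻ b v (a ∷ w) bv⊑aw with ⊑-∷⁻ a b v w bv⊑aw
... | inj₁ bv⊑w = ⊑-∷ʳ a v w (⊑-∷ˡ⁻ b v w bv⊑w)
... | inj₂ v⊑w  = ⊑-∷ʳ a v w v⊑w

⊑⇒length≤ : ∀ v w → v ⊑ w → length v ≤ length w
⊑⇒length≤ []      w       _ = z≤n
⊑⇒length≤ (b ∷ v) (a ∷ w) bv⊑aw with ⊑-∷⁻ a b v w bv⊑aw
... | inj₁ bv⊑w = m≤n⇒m≤1+n (⊑⇒length≤ (b ∷ v) w bv⊑w)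
... | inj₂ v⊑w  = s≤s (⊑⇒length≤ v w v⊑w)

∷-⊑-∷⇔ : ∀ a v w → (a ∷ v ⊑ a ∷ w) ⇔ (v ⊑ w)
∷-⊑-∷⇔ a v w = mk⇔ drop keep
  where
  drop : a ∷ v ⊑ a ∷ w → v ⊑ w
  drop av⊑aw with ⊑-∷⁻ a a v w av⊑aw
  ... | inj₁ av⊑w = ⊑-∷ˡ⁻ a v w av⊑w
  ... | inj₂ v⊑w  = v⊑w
  binom-∷-∷ : ∀ a → binom (a ∷ w) (a ∷ v) ≡ binom w (a ∷ v) + binom w v
  binom-∷-∷ true  = refl
  binom-∷-∷ false = refl
  keep : v ⊑ w → a ∷ v ⊑ a ∷ w
  keep v⊑w = subst (0 <_) (sym (binom-∷-∷ a)) (≤-trans v⊑w (m≤n+m _ _))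

∷-⊑-not∷⇔ : ∀ b v w → (b ∷ v ⊑ not b ∷ w) ⇔ (b ∷ v ⊑ w)
∷-⊑-not∷⇔ b v w = mk⇔ (subst (0 <_) (binom-skip b)) (subst (0 <_) (sym (binom-skip b)))
  where
  binom-skip : ∀ b → binom (not b ∷ w) (b ∷ v) ≡ binom w (b ∷ v)
  binom-skip true  = +-identityʳ _
  binom-skip false = +-identityʳ _

#subwordsUpTo : ℕ → Word → ℕ
#subwordsUpTo n w = ∑ (wordsUpTo n) (λ v → 𝟙[ v ⊑? w ])

#subwordsUpTo-stable : ∀ n w → length w ≤ n → #subwordsUpTo (suc n) w ≡ #subwordsUpTo n w
#subwordsUpTo-stable n w |w|≤n = ∑-wordsUpTo-suc-vanishing n _ too-long
  where
  too-long : ∀ v → length v ≡ suc n → 𝟙[ v ⊑? w ] ≡ 0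
  too-long v |v|≡1+n = 𝟙-no (v ⊑? w) λ v⊑w →
    <⇒≱ (s≤s |w|≤n) (subst (_≤ length w) |v|≡1+n (⊑⇒length≤ v w v⊑w))

#subwordsUpTo-0∷1∷ : ∀ n w →
  #subwordsUpTo (suc n) (false ∷ true ∷ w) ≡ 1 + #subwordsUpTo n (true ∷ w) + #subwordsUpTo n w
#subwordsUpTo-0∷1∷ n w = trans (∑-wordsUpTo-suc n _)
  (cong₂ (λ s t → 1 + s + t) (∑-cong (wordsUpTo n) via-0) (∑-cong (wordsUpTo n) via-1))
  where
  via-0 : ∀ x → 𝟙[ false ∷ x ⊑? false ∷ true ∷ w ] ≡ 𝟙[ x ⊑? true ∷ w ]
  via-0 x = 𝟙-⇔ (∷-⊑-∷⇔ false x (true ∷ w)) (false ∷ x ⊑? false ∷ true ∷ w) (x ⊑? true ∷ w)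
  via-1 : ∀ x → 𝟙[ true ∷ x ⊑? false ∷ true ∷ w ] ≡ 𝟙[ x ⊑? w ]
  via-1 x = 𝟙-⇔ (⇔-trans (∷-⊑-not∷⇔ true x (true ∷ w)) (∷-⊑-∷⇔ true x w))
                 (true ∷ x ⊑? false ∷ true ∷ w) (x ⊑? w)

countL₂-1∷ : ∀ w → countL₂ (true ∷ w) ≡ 1 + #subwordsUpTo (length w) w
countL₂-1∷ w = begin
  length (filter (Counted? (true ∷ w)) (wordsUpTo (suc (length w))))
    ≡⟨ length-filter≡∑𝟙 (Counted? (true ∷ w)) (wordsUpTo (suc (length w))) ⟩
  ∑ (wordsUpTo (suc (length w))) (λ v → 𝟙[ Counted? (true ∷ w) v ])
    ≡⟨ ∑-wordsUpTo-suc (length w) _ ⟩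
  𝟙[ Counted? (true ∷ w) [] ] + ∑ ws (λ x → 𝟙[ Counted? (true ∷ w) (false ∷ x) ])
                              + ∑ ws (λ x → 𝟙[ Counted? (true ∷ w) (true ∷ x) ])
    ≡⟨ cong₂ (λ s t → 1 + s + t) (∑-zero ws (λ x → 𝟙-no (Counted? (true ∷ w) (false ∷ x)) λ { (counted () _) }))
                                 (∑-cong ws (λ x → 𝟙-⇔ Counted-1∷⇔ (Counted? (true ∷ w) (true ∷ x)) (x ⊑? w))) ⟩
  1 + #subwordsUpTo (length w) w
    ∎
  where
  open ≡-Reasoning
  ws : List Word
  ws = wordsUpTo (length w)
  Counted-1∷⇔ : ∀ {x} → Counted (true ∷ w) (true ∷ x) ⇔ (x ⊑ w)
  Counted-1∷⇔ {x} = mk⇔ (λ { (counted _ 1x⊑1w) → Equivalence.to (∷-⊑-∷⇔ true x w) 1x⊑1w })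
                        (λ x⊑w → counted (L₂-1 x) (Equivalence.from (∷-⊑-∷⇔ true x w) x⊑w))

lemma3p4 : (u : Word) →
    countL₂ (true ∷ false ∷ true ∷ u) ≡ countL₂ (true ∷ u) + countL₂ (true ∷ true ∷ u)
lemma3p4 u = begin
  countL₂ (true ∷ false ∷ true ∷ u)
    ≡⟨ countL₂-1∷ (false ∷ true ∷ u) ⟩
  1 + #subwordsUpTo (suc (suc n)) (false ∷ true ∷ u)
    ≡⟨ cong suc (#subwordsUpTo-0∷1∷ (suc n) u) ⟩
  2 + #subwordsUpTo (suc n) (true ∷ u) + #subwordsUpTo (suc n) u
    ≡⟨ cong (2 + #subwordsUpTo (suc n) (true ∷ u) +_) (#subwordsUpTo-stable n u ≤-refl) ⟩
  2 + #subwordsUpTo (suc n) (true ∷ u) + #subwordsUpTo n u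
    ≡⟨ rearrange _ _ ⟩
  (1 + #subwordsUpTo n u) + (1 + #subwordsUpTo (suc n) (true ∷ u))
    ≡⟨ sym (cong₂ _+_ (countL₂-1∷ u) (countL₂-1∷ (true ∷ u))) ⟩
  countL₂ (true ∷ u) + countL₂ (true ∷ true ∷ u)
    ∎
  where
  open ≡-Reasoning
  n : ℕ
  n = length u
  rearrange : ∀ s t → 2 + s + t ≡ (1 + t) + (1 + s)
  rearrange = solve-∀
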